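{- Let $p$ be a prime, $n\ge1$ an integer, and $d$ an integer with $p^n-1\le d<2p^n-1$. Let $D$ be the set of integers in $\{1,\dots,d\}$ that are prime to $p$. Then $\pi_p(D)=\frac{1}{n(p-1)}$.
   Context: $\sigma_p(N)$ is the sum of base-$p$ digits of $N\ge0$. Writing $D=\{d_1,\dots,d_k\}$, for $m\ge1$ let $E_D(m)$ be the set of $(u_1,\dots,u_k)\in\{0,\dots,p^m-1\}^k\setminus\{0\}$ with $\sum_iu_id_i\equiv0\pmod{p^m-1}$ and $\sum_iu_id_i>0$; $\sigma_p(D,m)=\min_{U\in E_D(m)}\sum_i\sigma_p(u_i)$, and $\pi_p(D)=\frac{1}{p-1}\min_{m\ge1}\frac{\sigma_p(D,m)}{m}$. -}

module Defs where

open import Data.Nat using (ℕ; zero; suc; _+_; _*_; _∸_; _^_; _≤_; _<_; NonZero; NonTrivial; nonTrivial⇒nonZero)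
open import Data.Nat.DivMod using (_/_; _%_)
open import Data.Nat.Divisibility using (_∣_; _∣?_)
open import Data.Nat.ListAction using (sum)
open import Data.List using (List; filter; map; upTo; length)
open import Data.Vec using (Vec; []; _∷_; fromList; zipWith; replicate; toList)
open import Data.Vec.Relation.Unary.All using (All)
open import Data.Product using (Σ; ∃; ∃-syntax; _×_; _,_)
open import Relation.Nullary using (¬_; ¬?)
open import Relation.Binary.PropositionalEquality using (_≡_; _≢_)
open import Data.Integer using (+_)
open import Data.Rational using (ℚ) renaming (_/_ to _/ℚ_; _≤_ to _≤ℚ_; _*_ to _*ℚ_)

pred-nonZero : ∀ p → .{{NonTrivial p}} → NonZero (p ∸ 1)
pred-nonZero (suc (suc k)) = _

-- Sum of the base-p digits of N (p ≥ 2).  Fuel N suffices since N / p < N for N > 0.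
digitSumFuel : (p : ℕ) → .{{NonZero p}} → (fuel N : ℕ) → ℕ
digitSumFuel p zero       N = 0
digitSumFuel p (suc fuel) N = N % p + digitSumFuel p fuel (N / p)

σ : (p : ℕ) → .{{NonTrivial p}} → ℕ → ℕ
σ p N = digitSumFuel p {{nonTrivial⇒nonZero p}} N N

σ-sum : (p : ℕ) → .{{NonTrivial p}} → ∀ {k} → Vec ℕ k → ℕ
σ-sum p [] = 0
σ-sum p (u ∷ us) = σ p u + σ-sum p us

weighted : ∀ {k} → Vec ℕ k → Vec ℕ k → ℕ
weighted us ds = sum (toList (zipWith _*_ us ds))

primeToSet : (p d : ℕ) → List ℕ
primeToSet p d = filter (λ x → ¬? (p ∣? x)) (map suc (upTo d))

InE : (p : ℕ) (D : List ℕ) (m : ℕ) → Vec ℕ (length D) → Set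
InE p D m U =
  All (λ u → u < p ^ m) U
  × U ≢ replicate (length D) 0
  × (p ^ m ∸ 1) ∣ weighted U (fromList D)
  × 0 < weighted U (fromList D)

IsσD : (p : ℕ) → .{{NonTrivial p}} → (D : List ℕ) (m s : ℕ) → Set
IsσD p D m s =
  (∃[ U ] (InE p D m U × σ-sum p U ≡ s))
  × (∀ U → InE p D m U → s ≤ σ-sum p U)

ratio : (p : ℕ) → .{{NonTrivial p}} → (s m : ℕ) → .{{NonZero m}} → ℚ
ratio p s m = (+ s) /ℚ (p ∸ 1) *ℚ ((+ 1) /ℚ m)
  where instance _ = pred-nonZero p

IsπD : (p : ℕ) → .{{NonTrivial p}} → (D : List ℕ) → ℚ → Set
IsπD p D r =
  (∃[ m ] ∃[ s ] Σ (NonZero m) λ nz → IsσD p D m s × r ≡ ratio p s m {{nz}})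
  × (∀ m s → (nz : NonZero m) → IsσD p D m s → r ≤ℚ ratio p s m {{nz}})

module Submission where

-- Lower bound.  Let U ∈ E_D(m) and N = Σ u_i d_i.  Then N is a positive multiple of
-- p^m - 1, and every positive multiple of p^m - 1 has digit sum at least m(p-1)
-- (fold N in base p^m: this keeps the residue mod p^m - 1 and does not increase σ).
-- Since σ is subadditive and submultiplicative, σ N ≤ Σ σ(u_i) σ(d_i), and every
-- d < 2p^n - 1 has σ d ≤ n(p-1).  Hence m(p-1) ≤ n(p-1) Σ σ(u_i), i.e. σ_p(D,m)/m ≥ 1/n.
-- Upper bound.  p^n - 1 ∈ D, so the unit vector at p^n - 1 lies in E_D(n) with Σ σ(u_i) = 1.

open import Data.Nat.Base using (ℕ; NonTrivial)
open import Defs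

module DigitSum (p : ℕ) .{{p-nonTrivial : NonTrivial p}} where

  open import Data.Nat
  open import Data.Nat.Properties
  open import Data.Nat.DivMod
  open import Data.Nat.Divisibility
  open import Data.Nat.Induction using (<-rec)
  open import Data.Nat.Tactic.RingSolver using (solve-∀)
  open import Data.Sum using (inj₁; inj₂)
  open import Relation.Nullary using (yes; no)
  open import Relation.Binary.PropositionalEquality

  instance
    p-nonZero : NonZero p
    p-nonZero = nonTrivial⇒nonZero p

  1<p : 1 < p
  1<p = nonTrivial⇒n>1 p

  1<p^suc : ∀ k → 1 < p ^ suc k
  1<p^suc k = ^-monoʳ-< p 1<p {0} {suc k} z<s

  quotient< : ∀ N → .{{NonZero N}} → N / p < N
  quotient< N = m/n<m N p 1<p

  digitSumFuel-zero : ∀ f → digitSumFuel p f 0 ≡ 0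
  digitSumFuel-zero zero    = refl
  digitSumFuel-zero (suc f) = cong₂ _+_ (m<n⇒m%n≡m {n = p} (>-nonZero⁻¹ p))
    (trans (cong (digitSumFuel p f) (0/n≡0 p)) (digitSumFuel-zero f))

  fuel-irrelevant : ∀ {f g} N → N ≤ f → N ≤ g → digitSumFuel p f N ≡ digitSumFuel p g N
  fuel-irrelevant {f} {g} zero _ _ = trans (digitSumFuel-zero f) (sym (digitSumFuel-zero g))
  fuel-irrelevant {suc f} {suc g} (suc N) (s≤s N≤f) (s≤s N≤g) =
    cong (suc N % p +_) (fuel-irrelevant (suc N / p) (≤-trans q≤N N≤f) (≤-trans q≤N N≤g))
    where
    q≤N : suc N / p ≤ N
    q≤N = ≤-pred (quotient< (suc N))

  σ-unfold : ∀ N → σ p N ≡ N % p + σ p (N / p)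
  σ-unfold zero = sym (cong₂ _+_ (m<n⇒m%n≡m {n = p} (>-nonZero⁻¹ p)) (cong (σ p) (0/n≡0 p)))
  σ-unfold (suc N) = cong (suc N % p +_) (fuel-irrelevant (suc N / p) (≤-pred (quotient< (suc N))) ≤-refl)

  σ-digit : ∀ r x → r < p → σ p (r + x * p) ≡ r + σ p x
  σ-digit r x r<p = begin
    σ p (r + x * p)                                ≡⟨ σ-unfold (r + x * p) ⟩
    (r + x * p) % p + σ p ((r + x * p) / p)        ≡⟨ cong₂ (λ a b → a + σ p b) last-digit remaining ⟩
    r + σ p x                                      ∎
    where
    open ≡-Reasoning
    last-digit : (r + x * p) % p ≡ r
    last-digit = trans ([m+kn]%n≡m%n r x p) (m<n⇒m%n≡m r<p)
    remaining : (r + x * p) / p ≡ x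
    remaining = trans (+-distrib-/-∣ʳ r (divides x refl)) (cong₂ _+_ (m<n⇒m/n≡0 r<p) (m*n/n≡m x p))

  data LastDigit : ℕ → Set where
    split : ∀ r x → r < p → LastDigit (r + x * p)

  lastDigit : ∀ N → LastDigit N
  lastDigit N = subst LastDigit (sym (m≡m%n+[m/n]*n N p)) (split (N % p) (N / p) (m%n<n N p))

  data Expansion : ℕ → Set where
    []  : Expansion 0
    _∷_ : ∀ {r x} → r < p → Expansion x → Expansion (r + x * p)

  expansion : ∀ N → Expansion N
  expansion = <-rec Expansion step
    where
    step : ∀ N → (∀ {M} → M < N → Expansion M) → Expansion N
    step zero    _  = []
    step (suc N) ih = subst Expansion (sym (m≡m%n+[m/n]*n (suc N) p))
                        (m%n<n (suc N) p ∷ ih (quotient< (suc N)))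

  σ-one : σ p 1 ≡ 1
  σ-one = σ-digit 1 0 1<p

  σ-*p : ∀ x → σ p (x * p) ≡ σ p x
  σ-*p x = σ-digit 0 x (>-nonZero⁻¹ p)

  -- Adding one increases the digit sum by at most one: either the last digit grows,
  -- or it is p - 1 and the carry passes to the higher digits.
  σ-suc : ∀ c → σ p (suc c) ≤ suc (σ p c)
  σ-suc c = go (expansion c)
    where
    go : ∀ {c} → Expansion c → σ p (suc c) ≤ suc (σ p c)
    go [] = ≤-reflexive σ-one
    go (_∷_ {r} {x} r<p ex) with m≤n⇒m<n∨m≡n r<p
    ... | inj₁ 1+r<p = ≤-reflexive (trans (σ-digit (suc r) x 1+r<p) (cong suc (sym (σ-digit r x r<p))))
    ... | inj₂ 1+r≡p = begin
      σ p (suc r + x * p)   ≡⟨ cong (λ z → σ p (z + x * p)) 1+r≡p ⟩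
      σ p (suc x * p)       ≡⟨ σ-*p (suc x) ⟩
      σ p (suc x)           ≤⟨ go ex ⟩
      suc (σ p x)           ≤⟨ s≤s (m≤n+m (σ p x) r) ⟩
      suc (r + σ p x)       ≡⟨ cong suc (σ-digit r x r<p) ⟨
      suc (σ p (r + x * p)) ∎
      where open ≤-Reasoning

  σ-+ˡ : ∀ r b → σ p (r + b) ≤ r + σ p b
  σ-+ˡ zero    b = ≤-refl
  σ-+ˡ (suc r) b = ≤-trans (σ-suc (r + b)) (s≤s (σ-+ˡ r b))

  σ-+-shifted : ∀ x → (∀ y → σ p (x + y) ≤ σ p x + σ p y) → ∀ c → σ p (c + x * p) ≤ σ p c + σ p x
  σ-+-shifted x sub c with lastDigit c
  ... | split t y t<p = begin
    σ p (t + y * p + x * p)       ≡⟨ cong (σ p) (regroup t y x p) ⟩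
    σ p (t + (x + y) * p)         ≡⟨ σ-digit t (x + y) t<p ⟩
    t + σ p (x + y)               ≤⟨ +-monoʳ-≤ t (sub y) ⟩
    t + (σ p x + σ p y)           ≡⟨ swap t (σ p x) (σ p y) ⟩
    (t + σ p y) + σ p x           ≡⟨ cong (_+ σ p x) (σ-digit t y t<p) ⟨
    σ p (t + y * p) + σ p x       ∎
    where
    open ≤-Reasoning
    regroup : ∀ t y x p → t + y * p + x * p ≡ t + (x + y) * p
    regroup = solve-∀
    swap : ∀ a b c → a + (b + c) ≡ (a + c) + b
    swap = solve-∀

  σ-subadditive : ∀ a b → σ p (a + b) ≤ σ p a + σ p b
  σ-subadditive a = go (expansion a)
    where
    go : ∀ {a} → Expansion a → ∀ b → σ p (a + b) ≤ σ p a + σ p b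
    go [] b = ≤-refl
    go (_∷_ {r} {x} r<p ex) b = begin
      σ p (r + x * p + b)           ≡⟨ cong (σ p) (regroup r x b p) ⟩
      σ p (r + b + x * p)           ≤⟨ σ-+-shifted x (go ex) (r + b) ⟩
      σ p (r + b) + σ p x           ≤⟨ +-monoˡ-≤ (σ p x) (σ-+ˡ r b) ⟩
      r + σ p b + σ p x             ≡⟨ swap r (σ p b) (σ p x) ⟩
      r + σ p x + σ p b             ≡⟨ cong (_+ σ p b) (σ-digit r x r<p) ⟨
      σ p (r + x * p) + σ p b       ∎
      where
      open ≤-Reasoning
      regroup : ∀ r x b p → r + x * p + b ≡ r + b + x * p
      regroup = solve-∀
      swap : ∀ a b c → a + b + c ≡ a + c + b
      swap = solve-∀

  σ-*ˡ : ∀ r d → σ p (r * d) ≤ r * σ p d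
  σ-*ˡ zero    d = z≤n
  σ-*ˡ (suc r) d = ≤-trans (σ-subadditive d (r * d)) (+-monoʳ-≤ (σ p d) (σ-*ˡ r d))

  σ-submultiplicative : ∀ u d → σ p (u * d) ≤ σ p u * σ p d
  σ-submultiplicative u d = go (expansion u)
    where
    go : ∀ {u} → Expansion u → σ p (u * d) ≤ σ p u * σ p d
    go [] = z≤n
    go (_∷_ {r} {x} r<p ex) = begin
      σ p ((r + x * p) * d)           ≡⟨ cong (σ p) (expand r x d p) ⟩
      σ p (r * d + (x * d) * p)       ≤⟨ σ-subadditive (r * d) ((x * d) * p) ⟩
      σ p (r * d) + σ p ((x * d) * p) ≡⟨ cong (σ p (r * d) +_) (σ-*p (x * d)) ⟩
      σ p (r * d) + σ p (x * d)       ≤⟨ +-mono-≤ (σ-*ˡ r d) (go ex) ⟩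
      r * σ p d + σ p x * σ p d       ≡⟨ *-distribʳ-+ (σ p d) r (σ p x) ⟨
      (r + σ p x) * σ p d             ≡⟨ cong (_* σ p d) (σ-digit r x r<p) ⟨
      σ p (r + x * p) * σ p d         ∎
      where
      open ≤-Reasoning
      expand : ∀ r x d p → (r + x * p) * d ≡ r * d + (x * d) * p
      expand = solve-∀

  high-digits< : ∀ {r c q} → r + c * p < p * q → c < q
  high-digits< {r} {c} {q} lt = *-cancelʳ-< p c q (begin-strict
    c * p      ≤⟨ m≤n+m (c * p) r ⟩
    r + c * p  <⟨ lt ⟩
    p * q      ≡⟨ *-comm p q ⟩
    q * p      ∎)
    where open ≤-Reasoning

  σ-concat : ∀ m b a → b < p ^ m → σ p (b + a * p ^ m) ≡ σ p b + σ p a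
  σ-concat zero    zero    a _         = cong (σ p) (*-identityʳ a)
  σ-concat zero    (suc b) a (s≤s ())
  σ-concat (suc m) b       a b<p^m+1 with lastDigit b
  ... | split r c r<p = begin
    σ p (r + c * p + a * (p * p ^ m)) ≡⟨ cong (σ p) (regroup r c a p (p ^ m)) ⟩
    σ p (r + (c + a * p ^ m) * p)     ≡⟨ σ-digit r (c + a * p ^ m) r<p ⟩
    r + σ p (c + a * p ^ m)           ≡⟨ cong (r +_) (σ-concat m c a (high-digits< {r} b<p^m+1)) ⟩
    r + (σ p c + σ p a)               ≡⟨ +-assoc r (σ p c) (σ p a) ⟨
    r + σ p c + σ p a                 ≡⟨ cong (_+ σ p a) (σ-digit r c r<p) ⟨
    σ p (r + c * p) + σ p a           ∎
    where
    open ≡-Reasoning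
    regroup : ∀ r c a p q → r + c * p + a * (p * q) ≡ r + (c + a * q) * p
    regroup = solve-∀

  -- For positive a, b:  (a - 1) + (b - 1)·a = a·b - 1; with a = p, b = p^n it says
  -- that appending the digit p - 1 to p^n - 1 gives p^(n+1) - 1.
  nines : ∀ {a b} → 0 < a → 0 < b → (a ∸ 1) + (b ∸ 1) * a ≡ a * b ∸ 1
  nines {suc a} {suc b} _ _ = identity a b
    where
    identity : ∀ a b → a + b * suc a ≡ b + a * suc b
    identity = solve-∀

  complement-digits : ∀ n {r a} → r < p → a < p ^ n →
    p ^ suc n ∸ 1 ∸ (r + a * p) ≡ (p ∸ 1 ∸ r) + (p ^ n ∸ 1 ∸ a) * p
  complement-digits n {r} {a} r<p a<p^n = begin
    p ^ suc n ∸ 1 ∸ (r + a * p)                          ≡⟨ cong (_∸ (r + a * p)) split-sum ⟨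
    (r + a * p) + (r' + a' * p) ∸ (r + a * p)            ≡⟨ m+n∸m≡n (r + a * p) (r' + a' * p) ⟩
    r' + a' * p                                          ∎
    where
    open ≡-Reasoning
    r' = p ∸ 1 ∸ r
    a' = p ^ n ∸ 1 ∸ a
    regroup : ∀ r a r' a' p → (r + a * p) + (r' + a' * p) ≡ (r + r') + (a + a') * p
    regroup = solve-∀
    split-sum : (r + a * p) + (r' + a' * p) ≡ p ^ suc n ∸ 1
    split-sum = begin
      (r + a * p) + (r' + a' * p)   ≡⟨ regroup r a r' a' p ⟩
      (r + r') + (a + a') * p       ≡⟨ cong₂ (λ x y → x + y * p) (m+[n∸m]≡n (<⇒≤pred r<p))
                                                                 (m+[n∸m]≡n (<⇒≤pred a<p^n)) ⟩
      (p ∸ 1) + (p ^ n ∸ 1) * p     ≡⟨ nines (>-nonZero⁻¹ p) (m^n>0 p n) ⟩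
      p ^ suc n ∸ 1                 ∎

  σ-complement : ∀ n r → r < p ^ n → σ p r + σ p (p ^ n ∸ 1 ∸ r) ≡ n * (p ∸ 1)
  σ-complement zero    zero    _ = refl
  σ-complement zero    (suc r) (s≤s ())
  σ-complement (suc n) r       r<p^n+1 with lastDigit r
  ... | split r a r<p = begin
    σ p (r + a * p) + σ p (p ^ suc n ∸ 1 ∸ (r + a * p)) ≡⟨ cong (λ z → σ p (r + a * p) + σ p z) complement ⟩
    σ p (r + a * p) + σ p (r' + a' * p)                 ≡⟨ cong₂ _+_ (σ-digit r a r<p) (σ-digit r' a' r'<p) ⟩
    (r + σ p a) + (r' + σ p a')                         ≡⟨ regroup r (σ p a) r' (σ p a') ⟩
    (r + r') + (σ p a + σ p a')                         ≡⟨ cong₂ _+_ (m+[n∸m]≡n (<⇒≤pred r<p)) (σ-complement n a a<p^n) ⟩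
    (p ∸ 1) + n * (p ∸ 1)                               ∎
    where
    open ≡-Reasoning
    r' = p ∸ 1 ∸ r
    a' = p ^ n ∸ 1 ∸ a
    a<p^n : a < p ^ n
    a<p^n = high-digits< {r} r<p^n+1
    complement : p ^ suc n ∸ 1 ∸ (r + a * p) ≡ r' + a' * p
    complement = complement-digits n r<p a<p^n
    r'<p : r' < p
    r'<p = m≤pred[n]⇒suc[m]≤n (m∸n≤m (p ∸ 1) r)
    regroup : ∀ a b c d → (a + b) + (c + d) ≡ (a + c) + (b + d)
    regroup = solve-∀

  σ-positive : ∀ {N} → 0 < N → 0 < σ p N
  σ-positive {N} = go (expansion N)
    where
    go : ∀ {N} → Expansion N → 0 < N → 0 < σ p N
    go (_∷_ {zero}  {zero}  _   _)  ()
    go (_∷_ {zero}  {suc x} _   ex) _ = subst (0 <_) (sym (σ-*p (suc x))) (go ex z<s)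
    go (_∷_ {suc r} {x}     r<p _)  _ = subst (0 <_) (sym (σ-digit (suc r) x r<p)) z<s

  σ-all-nines : ∀ n → σ p (p ^ n ∸ 1) ≡ n * (p ∸ 1)
  σ-all-nines n = σ-complement n 0 (m^n>0 p n)

  σ-< : ∀ n {x} → x < p ^ n → σ p x ≤ n * (p ∸ 1)
  σ-< n {x} x<p^n = ≤-trans (m≤m+n (σ p x) _) (≤-reflexive (σ-complement n x x<p^n))

  σ-<-nines : ∀ n {x} → x < p ^ n ∸ 1 → suc (σ p x) ≤ n * (p ∸ 1)
  σ-<-nines n {x} x<p^n-1 = begin
    suc (σ p x)                       ≡⟨ +-comm 1 (σ p x) ⟩
    σ p x + 1                         ≤⟨ +-monoʳ-≤ (σ p x) (σ-positive (m<n⇒0<n∸m x<p^n-1)) ⟩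
    σ p x + σ p (p ^ n ∸ 1 ∸ x)       ≡⟨ σ-complement n x x<p^n ⟩
    n * (p ∸ 1)                       ∎
    where
    open ≤-Reasoning
    x<p^n : x < p ^ n
    x<p^n = <-≤-trans x<p^n-1 (m∸n≤m (p ^ n) 1)

  -- The bound behind the theorem: every x < 2p^n - 1 has σ x ≤ n·(p - 1).
  -- Below p^n this is σ-<; otherwise x = r + p^n with r < p^n - 1 and σ x = σ r + 1.
  σ-<-twice : ∀ n {x} → x < 2 * p ^ n ∸ 1 → σ p x ≤ n * (p ∸ 1)
  σ-<-twice n {x} x<2q-1 with x <? p ^ n
  ... | yes x<q = σ-< n x<q
  ... | no  x≮q = begin
    σ p x               ≡⟨ cong (σ p) x≡r+q ⟩
    σ p (r + 1 * q)     ≡⟨ σ-concat n r 1 r<q ⟩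
    σ p r + σ p 1       ≡⟨ cong (σ p r +_) σ-one ⟩
    σ p r + 1           ≡⟨ +-comm (σ p r) 1 ⟩
    suc (σ p r)         ≤⟨ σ-<-nines n r<q-1 ⟩
    n * (p ∸ 1)         ∎
    where
    open ≤-Reasoning
    q = p ^ n
    r = x ∸ q
    q≤x : q ≤ x
    q≤x = ≮⇒≥ x≮q
    x≡r+q : x ≡ r + 1 * q
    x≡r+q = sym (trans (cong (r +_) (*-identityˡ q)) (m∸n+n≡m q≤x))
    2q-1≡q+[q-1] : 2 * q ∸ 1 ≡ q + (q ∸ 1)
    2q-1≡q+[q-1] = trans (cong (λ z → q + z ∸ 1) (+-identityʳ q)) (+-∸-assoc q (m^n>0 p n))
    r<q-1 : r < q ∸ 1
    r<q-1 = +-cancelˡ-< q r (q ∸ 1) (subst₂ _<_ (sym (m+[n∸m]≡n q≤x)) 2q-1≡q+[q-1] x<2q-1)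
    r<q : r < q
    r<q = <-≤-trans r<q-1 (m∸n≤m q 1)

  multiple≤⇒≡ : ∀ {t N} → 0 < N → N ≤ t → t ∣ N → N ≡ t
  multiple≤⇒≡ 0<N N≤t t∣N = ≤-antisym N≤t (∣⇒≤ {{>-nonZero 0<N}} t∣N)

  -- Writing N = b + a·p^m with b < p^m, the number b + a is again a positive multiple
  -- of p^m - 1, it is smaller than N when a > 0, and σ(b + a) ≤ σ b + σ a = σ N.
  -- When a = 0, N itself is p^m - 1.
  σ-multiple : ∀ m {N} → 0 < N → (p ^ m ∸ 1) ∣ N → m * (p ∸ 1) ≤ σ p N
  σ-multiple zero    _ _ = z≤n
  σ-multiple (suc k) {N} = <-rec Bound descend N
    where
    q = p ^ suc k
    t = q ∸ 1
    instance
      q-nonZero : NonZero q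
      q-nonZero = m^n≢0 p (suc k)
    1<q : 1 < q
    1<q = 1<p^suc k
    q≡1+t : q ≡ suc t
    q≡1+t = sym (suc-pred q)

    Bound : ℕ → Set
    Bound N = 0 < N → t ∣ N → suc k * (p ∸ 1) ≤ σ p N

    descend-from : ∀ {N} b a → N ≡ b + a * q → b < q → (∀ {M} → M < N → Bound M) → Bound N
    descend-from b zero    refl b<q _ pos t∣b =
      ≤-reflexive (trans (sym (σ-all-nines (suc k))) (cong (σ p) (sym (multiple≤⇒≡ pos b≤t t∣b))))
      where
      b≤t : b + 0 ≤ t
      b≤t = ≤-trans (≤-reflexive (+-identityʳ b)) (<⇒≤pred b<q)
    descend-from b (suc a) refl b<q ih _ t∣N = begin
      suc k * (p ∸ 1)       ≤⟨ ih N'<N z<N' t∣N' ⟩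
      σ p (b + suc a)       ≤⟨ σ-subadditive b (suc a) ⟩
      σ p b + σ p (suc a)   ≡⟨ σ-concat (suc k) b (suc a) b<q ⟨
      σ p (b + suc a * q)   ∎
      where
      open ≤-Reasoning
      N' = b + suc a
      N'<N : N' < b + suc a * q
      N'<N = +-monoʳ-< b (m<m*n (suc a) q 1<q)
      z<N' : 0 < N'
      z<N' = <-≤-trans z<s (m≤n+m (suc a) b)
      fold : ∀ b a t → b + a * suc t ≡ a * t + (b + a)
      fold = solve-∀
      N≡a*t+N' : b + suc a * q ≡ suc a * t + N'
      N≡a*t+N' = trans (cong (λ z → b + suc a * z) q≡1+t) (fold b (suc a) t)
      t∣N' : t ∣ N'
      t∣N' = ∣m+n∣m⇒∣n (subst (t ∣_) N≡a*t+N' t∣N) (n∣m*n (suc a))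

    descend : ∀ N → (∀ {M} → M < N → Bound M) → Bound N
    descend N = descend-from (N % q) (N / q) (m≡m%n+[m/n]*n N q) (m%n<n N q)

module NatFractions where

  open import Data.Nat as ℕ using (suc; NonZero)
  open import Data.Nat.Properties using (m*n≢0)
  open import Data.Integer as ℤ using (+_; +≤+)
  import Data.Integer.Properties as ℤ
  open import Data.Rational using (_/_; _≤_; _*_; toℚᵘ)
  open import Data.Rational.Properties using (toℚᵘ-fromℚᵘ; toℚᵘ-homo-*; toℚᵘ-cancel-≤; toℚᵘ-injective)
  import Data.Rational.Unnormalised as ℚᵘ
  import Data.Rational.Unnormalised.Properties as ℚᵘ
  open import Relation.Binary.PropositionalEquality

  toℚᵘ-/ : ∀ a b .{{_ : NonZero b}} → toℚᵘ ((+ a) / b) ℚᵘ.≃ ((+ a) ℚᵘ./ b)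
  toℚᵘ-/ a (suc b) = toℚᵘ-fromℚᵘ (ℚᵘ.mkℚᵘ (+ a) b)

  /-≤ : ∀ a b c d .{{_ : NonZero b}} .{{_ : NonZero d}} →
        a ℕ.* d ℕ.≤ c ℕ.* b → (+ a) / b ≤ (+ c) / d
  /-≤ a b@(suc _) c d@(suc _) ad≤cb = toℚᵘ-cancel-≤
    (ℚᵘ.≤-respˡ-≃ (ℚᵘ.≃-sym (toℚᵘ-/ a b)) (ℚᵘ.≤-respʳ-≃ (ℚᵘ.≃-sym (toℚᵘ-/ c d))
      (ℚᵘ.*≤* (subst₂ ℤ._≤_ (ℤ.pos-* a d) (ℤ.pos-* c b) (+≤+ ad≤cb)))))

  /-* : ∀ a b c d .{{_ : NonZero b}} .{{_ : NonZero d}} →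
        ((+ a) / b) * ((+ c) / d) ≡ _/_ (+ (a ℕ.* c)) (b ℕ.* d) {{m*n≢0 b d}}
  /-* a b@(suc _) c d@(suc _) = toℚᵘ-injective (begin
    toℚᵘ ((+ a) / b * ((+ c) / d))                 ≈⟨ toℚᵘ-homo-* ((+ a) / b) ((+ c) / d) ⟩
    toℚᵘ ((+ a) / b) ℚᵘ.* toℚᵘ ((+ c) / d)         ≈⟨ ℚᵘ.*-cong (toℚᵘ-/ a b) (toℚᵘ-/ c d) ⟩
    ((+ a) ℚᵘ./ b) ℚᵘ.* ((+ c) ℚᵘ./ d)             ≡⟨ cong (λ z → ℚᵘ.mkℚᵘ z (ℕ.pred (b ℕ.* d))) (ℤ.pos-* a c) ⟨
    (+ (a ℕ.* c)) ℚᵘ./ (b ℕ.* d)                   ≈⟨ toℚᵘ-/ (a ℕ.* c) (b ℕ.* d) ⟨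
    toℚᵘ ((+ (a ℕ.* c)) / (b ℕ.* d))               ∎)
    where open ℚᵘ.≃-Reasoning

module ExponentBounds (p : ℕ) .{{p-nonTrivial : NonTrivial p}} where

  open import Data.Nat
  open import Data.Nat.Properties
  open import Data.Nat.Divisibility
  open import Data.Nat.Tactic.RingSolver using (solve-∀)
  open import Data.List using (List; []; _∷_; length)
  open import Data.List.Relation.Unary.All as List using ([]; _∷_)
  open import Data.List.Relation.Unary.All.Properties using (filter⁺; map⁺; all-upTo)
  open import Data.List.Relation.Unary.Any using (here; there)
  open import Data.List.Membership.Propositional using (_∈_)
  open import Data.List.Membership.Propositional.Properties using (∈-filter⁺; ∈-map⁺; ∈-upTo⁺)
  open import Data.Vec as Vec using (Vec; []; _∷_; fromList; replicate)
  open import Data.Vec.Relation.Unary.All using (All; []; _∷_)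
  open import Data.Product using (_,_)
  import Data.Integer as ℤ
  import Data.Rational as ℚ
  open import Data.Rational.Properties using (/-cong)
  open import Relation.Nullary using (¬_; ¬?)
  open import Relation.Binary.PropositionalEquality
  open NatFractions using (/-≤; /-*)
  open DigitSum p

  instance
    p-1-nonZero : NonZero (p ∸ 1)
    p-1-nonZero = pred-nonZero p

  K-nonZero : ∀ n → 1 ≤ n → NonZero (n * (p ∸ 1))
  K-nonZero n n≥1 = m*n≢0 n (p ∸ 1) {{>-nonZero n≥1}}

  σ-weighted : ∀ K (D : List ℕ) → List.All (λ d → σ p d ≤ K) D → (U : Vec ℕ (length D)) →
               σ p (weighted U (fromList D)) ≤ K * σ-sum p U
  σ-weighted K [] [] [] = z≤n
  σ-weighted K (d ∷ D) (σd≤K ∷ σD≤K) (u ∷ U) = begin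
    σ p (u * d + weighted U (fromList D))          ≤⟨ σ-subadditive (u * d) _ ⟩
    σ p (u * d) + σ p (weighted U (fromList D))    ≤⟨ +-mono-≤ (σ-submultiplicative u d) (σ-weighted K D σD≤K U) ⟩
    σ p u * σ p d + K * σ-sum p U                  ≤⟨ +-monoˡ-≤ (K * σ-sum p U) (*-monoʳ-≤ (σ p u) σd≤K) ⟩
    σ p u * K + K * σ-sum p U                      ≡⟨ cong (_+ K * σ-sum p U) (*-comm (σ p u) K) ⟩
    K * σ p u + K * σ-sum p U                      ≡⟨ *-distribˡ-+ K (σ p u) (σ-sum p U) ⟨
    K * (σ p u + σ-sum p U)                        ∎
    where open ≤-Reasoning

  σ-sum-lower-bound : ∀ K (D : List ℕ) → List.All (λ d → σ p d ≤ K) D →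
                      ∀ m U → InE p D m U → m * (p ∸ 1) ≤ K * σ-sum p U
  σ-sum-lower-bound K D σD≤K m U (_ , _ , divisible , positive) =
    ≤-trans (σ-multiple m positive divisible) (σ-weighted K D σD≤K U)

  unit : ∀ {t} {D : List ℕ} → t ∈ D → Vec ℕ (length D)
  unit {D = _ ∷ D} (here _) = 1 ∷ replicate (length D) 0
  unit             (there i) = 0 ∷ unit i

  zeros-weighted : ∀ (D : List ℕ) → weighted (replicate (length D) 0) (fromList D) ≡ 0
  zeros-weighted []      = refl
  zeros-weighted (_ ∷ D) = zeros-weighted D

  zeros-σ-sum : ∀ k → σ-sum p (replicate k 0) ≡ 0
  zeros-σ-sum zero    = refl
  zeros-σ-sum (suc k) = zeros-σ-sum k

  zeros-bounded : ∀ k {B} → 0 < B → All (_< B) (replicate k 0)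
  zeros-bounded zero    _   = []
  zeros-bounded (suc k) 0<B = 0<B ∷ zeros-bounded k 0<B

  unit-weighted : ∀ {t D} (i : t ∈ D) → weighted (unit i) (fromList D) ≡ t
  unit-weighted {D = d ∷ D} (here refl) =
    trans (cong ((d + 0) +_) (zeros-weighted D)) (trans (+-identityʳ (d + 0)) (+-identityʳ d))
  unit-weighted (there i) = unit-weighted i

  unit-σ-sum : ∀ {t D} (i : t ∈ D) → σ-sum p (unit i) ≡ 1
  unit-σ-sum {D = _ ∷ D} (here _) = cong₂ _+_ σ-one (zeros-σ-sum (length D))
  unit-σ-sum (there i) = unit-σ-sum i

  unit-nonzero : ∀ {t D} (i : t ∈ D) → unit i ≢ replicate (length D) 0
  unit-nonzero (here _) ()
  unit-nonzero (there i) eq = unit-nonzero i (cong Vec.tail eq)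

  unit-bounded : ∀ {t D} (i : t ∈ D) → ∀ {B} → 1 < B → All (_< B) (unit i)
  unit-bounded {D = _ ∷ D} (here _) 1<B = 1<B ∷ zeros-bounded (length D) (<-trans z<s 1<B)
  unit-bounded (there i) 1<B = <-trans z<s 1<B ∷ unit-bounded i 1<B

  unit-∈E : ∀ m {D} (i : (p ^ m ∸ 1) ∈ D) → 1 < p ^ m → InE p D m (unit i)
  unit-∈E m i 1<p^m =
    unit-bounded i 1<p^m , unit-nonzero i ,
    subst (p ^ m ∸ 1 ∣_) (sym (unit-weighted i)) ∣-refl ,
    subst (0 <_) (sym (unit-weighted i)) (m<n⇒0<n∸m 1<p^m)

  primeToSet-σ-bound : ∀ n d → d < 2 * p ^ n ∸ 1 → List.All (λ x → σ p x ≤ n * (p ∸ 1)) (primeToSet p d)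
  primeToSet-σ-bound n d d<2q-1 =
    filter⁺ (λ x → ¬? (p ∣? x)) (map⁺ (List.map (λ y<d → σ-<-twice n (≤-<-trans y<d d<2q-1)) (all-upTo d)))

  ∈-primeToSet : ∀ {x} d → 0 < x → x ≤ d → ¬ (p ∣ x) → x ∈ primeToSet p d
  ∈-primeToSet {suc y} d _ x≤d p∤x = ∈-filter⁺ (λ x → ¬? (p ∣? x)) (∈-map⁺ suc (∈-upTo⁺ x≤d)) p∤x

  -- p^n - 1 belongs to D, since p divides p^n but not 1.
  nines-∈-primeToSet : ∀ n d → 1 ≤ n → p ^ n ∸ 1 ≤ d → p ^ n ∸ 1 ∈ primeToSet p d
  nines-∈-primeToSet n@(suc k) d _ t≤d = ∈-primeToSet d (m<n⇒0<n∸m 1<q) t≤d p∤t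
    where
    t = p ^ n ∸ 1
    1<q : 1 < p ^ n
    1<q = 1<p^suc k
    p∤t : ¬ (p ∣ t)
    p∤t p∣t = nonTrivial⇒≢1 (∣1⇒≡1 (∣m+n∣m⇒∣n p∣t+1 p∣t))
      where
      p∣t+1 : p ∣ t + 1
      p∣t+1 = subst (p ∣_) (sym (m∸n+n≡m (<⇒≤ 1<q))) (m∣m*n (p ^ k))

  ratio-one : ∀ n .{{_ : NonZero n}} → ℚ._/_ (ℤ.+ 1) (n * (p ∸ 1)) {{m*n≢0 n (p ∸ 1)}} ≡ ratio p 1 n
  ratio-one n = trans (/-cong {ℤ.+ 1} {n * (p ∸ 1)} {ℤ.+ 1} {(p ∸ 1) * n} {{m*n≢0 n (p ∸ 1)}} {{m*n≢0 (p ∸ 1) n}}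
                              refl (*-comm n (p ∸ 1)))
                      (sym (/-* 1 (p ∸ 1) 1 n))

  ratio-lower : ∀ K m s .{{_ : NonZero K}} .{{_ : NonZero m}} →
                m * (p ∸ 1) ≤ K * s → ℚ._/_ (ℤ.+ 1) K ℚ.≤ ratio p s m
  ratio-lower K m s {{K≢0}} m[p-1]≤Ks =
    subst (ℚ._/_ (ℤ.+ 1) K ℚ.≤_) (sym (/-* s (p ∸ 1) 1 m))
      (/-≤ 1 K (s * 1) ((p ∸ 1) * m) {{K≢0}} {{m*n≢0 (p ∸ 1) m}}
        (subst₂ _≤_ (rearrangeˡ m (p ∸ 1)) (rearrangeʳ K s) m[p-1]≤Ks))
    where
    rearrangeˡ : ∀ m a → m * a ≡ 1 * (a * m)
    rearrangeˡ = solve-∀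
    rearrangeʳ : ∀ K s → K * s ≡ s * 1 * K
    rearrangeʳ = solve-∀

  -- Every U ∈ E_D(m)
  -- has m·(p - 1) ≤ K·Σ σ(u_i) with K = n·(p - 1), and the unit vector at p^n - 1 attains
  -- Σ σ(u_i) = 1 at m = n.
  π-primeToSet : ∀ n → (n≥1 : 1 ≤ n) → ∀ d → p ^ n ∸ 1 ≤ d → d < 2 * p ^ n ∸ 1 →
                 IsπD p (primeToSet p d) (ℚ._/_ (ℤ.+ 1) (n * (p ∸ 1)) {{K-nonZero n n≥1}})
  π-primeToSet n@(suc k) n≥1 d t≤d d<2q-1 = (n , 1 , _ , σ-at-n , ratio-one n) , ratio-minimal
    where
    K = n * (p ∸ 1)
    instance
      K≢0 : NonZero K
      K≢0 = K-nonZero n n≥1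
    D = primeToSet p d
    lower-bound : ∀ m U → InE p D m U → m * (p ∸ 1) ≤ K * σ-sum p U
    lower-bound = σ-sum-lower-bound K D (primeToSet-σ-bound n d d<2q-1)
    t∈D = nines-∈-primeToSet n d n≥1 t≤d

    -- σ_p(D, n) = 1: the unit vector at p^n - 1 attains it, and K ≤ K·Σ σ(u_i)
    -- for every U ∈ E_D(n) forces Σ σ(u_i) ≥ 1.
    σ-at-n : IsσD p D n 1
    σ-at-n = (unit t∈D , unit-∈E n t∈D (1<p^suc k) , unit-σ-sum t∈D) ,
             λ U U∈E → *-cancelˡ-≤ K (subst (_≤ K * σ-sum p U) (sym (*-identityʳ K)) (lower-bound n U U∈E))

    ratio-minimal : ∀ m s (nz : NonZero m) → IsσD p D m s → ℚ._/_ (ℤ.+ 1) K ℚ.≤ ratio p s m {{nz}}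
    ratio-minimal m s nz ((U , U∈E , σU≡s) , _) =
      ratio-lower K m s {{K≢0}} {{nz}} (subst (λ z → m * (p ∸ 1) ≤ K * z) σU≡s (lower-bound m U U∈E))

-- The names in which the statement is phrased; opened only here, since the integer
-- sign +_ and the rational _/_ would clash with the ℕ notation used above.
open import Data.Nat using (ℕ; _≤_; _<_; _*_; _∸_; _^_; >-nonZero)
open import Data.Nat.Properties using (m*n≢0)
open import Data.Nat.Primality using (Prime; prime⇒nonTrivial)
open import Data.Integer using (+_)
open import Data.Rational using (_/_)

-- Theorem 1.3.
mainTheorem13 : (p : ℕ) (pr : Prime p) (n : ℕ) (n≥1 : 1 ≤ n) (d : ℕ)
    → p ^ n ∸ 1 ≤ d → d < 2 * p ^ n ∸ 1
    → IsπD p {{prime⇒nonTrivial pr}} (primeToSet p d)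
        (_/_ (+ 1) (n * (p ∸ 1))
          {{m*n≢0 n (p ∸ 1) {{>-nonZero n≥1}} {{pred-nonZero p {{prime⇒nonTrivial pr}}}}}})
mainTheorem13 p pr = ExponentBounds.π-primeToSet p {{prime⇒nonTrivial pr}}
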